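{- The recursion functionals $\mathcal R'$ and $\mathcal R$ are equivalent in the sense that $\mathcal R$ is represented by a closed type-two term of $\lambda(\mathsf{FP}\cup\{\mathcal R'\})$ and $\mathcal R'$ is represented by a closed type-two term of $\lambda(\mathsf{FP}\cup\{\mathcal R\})$.
   Context: Strings are over $\{0,1\}$; $\mathbf a^{\le n}$ is $\mathbf a$ truncated to its first $n$ symbols (unchanged if shorter); $\mathbf c i$ is $\mathbf c$ followed by bit $i$. $\mathsf{FP}$ is the class of polynomial-time computable (multi-argument) string functions. Types: $0$ is a type (interpreted as $\Sigma^*$), and $\sigma\to\tau$ is a type (interpreted as all functions from type-$\sigma$ to type-$\tau$ objects); level of $0$ is $0$, level of $\tau_1\to\dots\to\tau_k\to0$ is $1+\max$ level of $\tau_i$. For a class $X$ of functionals, $\lambda(X)$ is the set of simply-typed $\lambda$-terms built from typed variables, a constant symbol for each element of $X$, abstraction and application; a closed term denotes a functional in the standard set-theoretic semantics. The limited recursion functional is $\mathcal R(\varphi,\mathbf a,\mathbf b,\epsilon)=\mathbf a$, $\mathcal R(\varphi,\mathbf a,\mathbf b,\mathbf ci)=\varphi(\mathbf ci,\mathcal R(\varphi,\mathbf a,\mathbf b,\mathbf c))^{\le|\mathbf b|}$ (with $\varphi$ a binary string function). The Cook–Urquhart functional is $\mathcal R'(\varphi,\mathbf a,\psi,\epsilon)=\mathbf a$ and $\mathcal R'(\varphi,\mathbf a,\psi,\mathbf ci)=\mathbf t$ if $|\mathbf t|\le|\psi(\mathbf ci)|$, and $=\psi(\mathbf ci)$ otherwise,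 where $\mathbf t=\varphi(\mathbf ci,\mathcal R'(\varphi,\mathbf a,\psi,\mathbf c))$. -}

module Defs where

open import Data.Bool using (Bool; true; false; if_then_else_)
open import Data.Nat using (ℕ; zero; suc; _+_; _*_; _^_; _≤_; _≤ᵇ_)
open import Data.Fin using (Fin; zero; suc)
open import Data.List using (List; []; _∷_; _++_; map; take; length; reverse)
open import Data.Vec using (Vec; []; _∷_)
open import Data.Maybe using (Maybe; just; nothing)
open import Data.Product using (Σ; _×_; _,_)
open import Relation.Binary.PropositionalEquality using (_≡_)

-- Strings over {0,1}: false = 0, true = 1.  The first symbol of a string
-- is the head of the list; "c i" (c followed by bit i) is  c ++ (i ∷ []).

Str : Set
Str = List Bool

trunc : ℕ → Str → Str
trunc = take

data Move : Set where
  L R S : Move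

-- Tape alphabet Fin (4 + extra): 0 = blank, 1 = bit 0, 2 = bit 1,
-- 3 = separator '#', the remaining symbols are work symbols.
-- States Fin (suc nstate); the start state is zero.
-- δ returning nothing means: halt.
record TM : Set where
  field
    extra  : ℕ
    nstate : ℕ
    δ : Fin (suc nstate) → Fin (4 + extra) →
        Maybe (Fin (suc nstate) × Fin (4 + extra) × Move)
open TM public

Sym : TM → Set
Sym M = Fin (4 + extra M)

State : TM → Set
State M = Fin (suc (nstate M))

blank : (M : TM) → Sym M
blank M = zero

bitSym : (M : TM) → Bool → Sym M
bitSym M false = suc zero
bitSym M true  = suc (suc zero)

sepSym : (M : TM) → Sym M
sepSym M = suc (suc (suc zero))

-- configuration: state, cells left of the head (nearest first),
-- scanned symbol, cells right of the head (nearest first)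
record Config (M : TM) : Set where
  constructor conf
  field
    st    : State M
    left  : List (Sym M)
    head  : Sym M
    right : List (Sym M)

moveHead : (M : TM) → Move → List (Sym M) → Sym M → List (Sym M) →
           List (Sym M) × Sym M × List (Sym M)
moveHead M S l h r = l , h , r
moveHead M L [] h r = [] , blank M , h ∷ r
moveHead M L (x ∷ l) h r = l , x , h ∷ r
moveHead M R l h [] = h ∷ l , blank M , []
moveHead M R l h (x ∷ r) = h ∷ l , x , r

step : ∀ {M} → Config M → Config M
step {M} (conf q l h r) with δ M q h
... | nothing = conf q l h r
... | just (q' , s , m) with moveHead M m l s r
...   | (l' , h' , r') = conf q' l' h' r'

run : ∀ {M} → ℕ → Config M → Config M
run zero c = c
run (suc n) c = run n (step c)

Halted : ∀ {M} → Config M → Set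
Halted {M} (conf q l h r) = δ M q h ≡ nothing

encode : (M : TM) → ∀ {k} → Vec Str k → List (Sym M)
encode M [] = []
encode M (x ∷ []) = map (bitSym M) x
encode M (x ∷ y ∷ xs) = map (bitSym M) x ++ (sepSym M ∷ encode M (y ∷ xs))

initConf : ∀ {M k} → Vec Str k → Config M
initConf {M} xs with encode M xs
... | [] = conf zero [] (blank M) []
... | s ∷ ss = conf zero [] s ss

readBits : (M : TM) → List (Sym M) → Str
readBits M [] = []
readBits M (suc zero ∷ ss) = false ∷ readBits M ss
readBits M (suc (suc zero) ∷ ss) = true ∷ readBits M ss
readBits M (_ ∷ ss) = []

output : ∀ {M} → Config M → Str
output {M} (conf q l h r) = readBits M (h ∷ r)

inputSize : ∀ {k} → Vec Str k → ℕ
inputSize [] = 0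
inputSize (x ∷ xs) = length x + inputSize xs

IsFP : ∀ {k} → (Vec Str k → Str) → Set
IsFP {k} f =
  Σ TM λ M → Σ ℕ λ c → Σ ℕ λ d → (xs : Vec Str k) →
    Σ ℕ λ n → n ≤ c * (suc (inputSize xs)) ^ d
            × Halted (run {M} n (initConf xs))
            × output (run {M} n (initConf xs)) ≡ f xs

infixr 5 _⇒_
data Ty : Set where
  ι   : Ty
  _⇒_ : Ty → Ty → Ty

⟦_⟧ty : Ty → Set
⟦ ι ⟧ty = Str
⟦ σ ⇒ τ ⟧ty = ⟦ σ ⟧ty → ⟦ τ ⟧ty

arr : ℕ → Ty
arr zero = ι
arr (suc k) = ι ⇒ arr k

curryV : (k : ℕ) → (Vec Str k → Str) → ⟦ arr k ⟧ty
curryV zero f = f []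
curryV (suc k) f = λ x → curryV k (λ xs → f (x ∷ xs))

-- λ(X): simply typed λ-terms with a constant for each element of X.
-- A class of functionals is a predicate on typed functionals.

Class : Set₁
Class = (τ : Ty) → ⟦ τ ⟧ty → Set

Ctx : Set
Ctx = List Ty

data _∋_ : Ctx → Ty → Set where
  here  : ∀ {Γ τ} → (τ ∷ Γ) ∋ τ
  there : ∀ {Γ σ τ} → Γ ∋ τ → (σ ∷ Γ) ∋ τ

data Term (X : Class) (Γ : Ctx) : Ty → Set where
  var   : ∀ {τ} → Γ ∋ τ → Term X Γ τ
  const : ∀ {τ} (F : ⟦ τ ⟧ty) → X τ F → Term X Γ τ
  lam   : ∀ {σ τ} → Term X (σ ∷ Γ) τ → Term X Γ (σ ⇒ τ)
  app   : ∀ {σ τ} → Term X Γ (σ ⇒ τ) → Term X Γ σ → Term X Γ τ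

data Env : Ctx → Set where
  []  : Env []
  _∷_ : ∀ {τ Γ} → ⟦ τ ⟧ty → Env Γ → Env (τ ∷ Γ)

lookupEnv : ∀ {Γ τ} → Env Γ → Γ ∋ τ → ⟦ τ ⟧ty
lookupEnv (v ∷ ρ) here = v
lookupEnv (v ∷ ρ) (there x) = lookupEnv ρ x

⟦_⟧ : ∀ {X Γ τ} → Term X Γ τ → Env Γ → ⟦ τ ⟧ty
⟦ var x ⟧ ρ = lookupEnv ρ x
⟦ const F _ ⟧ ρ = F
⟦ lam t ⟧ ρ = λ v → ⟦ t ⟧ (v ∷ ρ)
⟦ app t u ⟧ ρ = ⟦ t ⟧ ρ (⟦ u ⟧ ρ)

ClosedTerm : Class → Ty → Set
ClosedTerm X τ = Term X [] τ

-- level of a type (for documentation: TyR and TyR' below have level 2)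
level : Ty → ℕ
level ι = 0
level (σ ⇒ τ) with level τ
... | m = Data.Nat._⊔_ (suc (level σ)) m

TyR : Ty
TyR = (ι ⇒ ι ⇒ ι) ⇒ ι ⇒ ι ⇒ ι ⇒ ι

TyR' : Ty
TyR' = (ι ⇒ ι ⇒ ι) ⇒ ι ⇒ (ι ⇒ ι) ⇒ ι ⇒ ι

-- recursion on the reversed recursion argument: the list  i ∷ rc
-- is the reversal of the string  c i  with  c = reverse rc
Rrev : (Str → Str → Str) → Str → Str → List Bool → Str
Rrev φ a b [] = a
Rrev φ a b (i ∷ rc) = trunc (length b) (φ (reverse (i ∷ rc)) (Rrev φ a b rc))

𝓡 : (Str → Str → Str) → Str → Str → Str → Str
𝓡 φ a b c = Rrev φ a b (reverse c)

R'rev : (Str → Str → Str) → Str → (Str → Str) → List Bool → Str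
R'rev φ a ψ [] = a
R'rev φ a ψ (i ∷ rc) =
  let ci = reverse (i ∷ rc)
      t  = φ ci (R'rev φ a ψ rc)
  in if length t ≤ᵇ length (ψ ci) then t else ψ ci

𝓡' : (Str → Str → Str) → Str → (Str → Str) → Str → Str
𝓡' φ a ψ c = R'rev φ a ψ (reverse c)

data FPClass : Class where
  fp : ∀ {k} (f : Vec Str k → Str) → IsFP f → FPClass (arr k) (curryV k f)

data FP+R' : Class where
  fpC : ∀ {τ F} → FPClass τ F → FP+R' τ F
  R'C : FP+R' TyR' 𝓡'

data FP+R : Class where
  fpC : ∀ {τ F} → FPClass τ F → FP+R τ F
  RC  : FP+R TyR 𝓡

-- 𝓡 φ a b is 𝓡' with step take |b| ∘ φ and constant bound λ _ → b, and truncation is itself a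
-- 𝓡'-recursion along s: keep the current prefix of s while it is no longer than b, bounded by s.
-- Conversely 𝓡' φ a ψ is 𝓡 with step cap (φ x y) (ψ x), as soon as the bound b is at least as
-- long as ψ p for every prefix p of c; b = ψ m works, where m is the prefix with the longest
-- ψ-image, found by a second 𝓡-recursion along c (its values are prefixes of c, so truncating
-- to |c| is harmless). Besides ε, the only polynomial-time function needed is
-- cond u w x y = if |u| ≤ |w| then x else y, computed in quadratic time by a Turing machine
-- that crosses off u and w bit by bit.

module Submission where

open import Defs
open import Data.Bool using (Bool; true; false; if_then_else_)
open import Data.Nat using (ℕ; zero; suc; _+_; _*_; _^_; _≤_; _≤ᵇ_; z≤n; s≤s)
open import Data.Nat.Properties
open import Data.Nat.Tactic.RingSolver using (solve-∀)
open import Data.Fin using (Fin; zero; suc)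
open import Data.List using (List; []; _∷_; _++_; _∷ʳ_; map; take; length; reverse; _ʳ++_; replicate)
open import Data.List.Properties
  using (length-map; length-replicate; ++-identityʳ; length-take; take-all; take-[]; length-++; length-reverse; unfold-reverse; reverse-involutive)
open import Data.List.Relation.Unary.All using (All; []; _∷_; universal)
open import Data.List.Relation.Unary.All.Properties using (map⁺; replicate⁺)
open import Data.Maybe using (Maybe; just; nothing)
open import Data.Product using (Σ; _×_; _,_; proj₂)
open import Data.Vec using (Vec; []; _∷_)
open import Data.Empty using (⊥-elim)
open import Data.Unit using (⊤; tt)
open import Relation.Nullary using (¬_; Dec; yes; no)
open import Relation.Nullary.Reflects using (ofʸ; ofⁿ)
open import Relation.Binary.PropositionalEquality

replicate-++-∷ : ∀ {A : Set} n (a : A) r → replicate n a ++ a ∷ r ≡ a ∷ replicate n a ++ r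
replicate-++-∷ zero    a r = refl
replicate-++-∷ (suc n) a r = cong (a ∷_) (replicate-++-∷ n a r)

≤ᵇ-suc : ∀ m n → (suc m ≤ᵇ suc n) ≡ (m ≤ᵇ n)
≤ᵇ-suc zero    n = refl
≤ᵇ-suc (suc m) n = refl

if-≤ᵇ : ∀ {A : Set} {m n} {x y : A} → m ≤ n → (if m ≤ᵇ n then x else y) ≡ x
if-≤ᵇ {m = m} {n} m≤n with m ≤ᵇ n | ≤ᵇ-reflects-≤ m n
... | true  | _       = refl
... | false | ofⁿ m≰n = ⊥-elim (m≰n m≤n)

if-≰ᵇ : ∀ {A : Set} {m n} {x y : A} → ¬ m ≤ n → (if m ≤ᵇ n then x else y) ≡ y
if-≰ᵇ {m = m} {n} m≰n with m ≤ᵇ n | ≤ᵇ-reflects-≤ m n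
... | true  | ofʸ m≤n = ⊥-elim (m≰n m≤n)
... | false | _       = refl

length-take≤n : ∀ {A : Set} n (xs : List A) → length (take n xs) ≤ n
length-take≤n n xs = ≤-trans (≤-reflexive (length-take n xs)) (m⊓n≤m n (length xs))

length-take≤length : ∀ {A : Set} n (xs : List A) → length (take n xs) ≤ length xs
length-take≤length n xs = ≤-trans (≤-reflexive (length-take n xs)) (m⊓n≤n n (length xs))

take-++ˡ : ∀ {A : Set} n (xs ys : List A) → n ≤ length xs → take n (xs ++ ys) ≡ take n xs
take-++ˡ zero    xs       ys n≤xs       = refl
take-++ˡ (suc n) (x ∷ xs) ys (s≤s n≤xs) = cong (x ∷_) (take-++ˡ n xs ys n≤xs)

take-∷ʳ : ∀ {A : Set} n (xs : List A) x →
          take n (xs ∷ʳ x) ≡ (if length (xs ∷ʳ x) ≤ᵇ n then xs ∷ʳ x else take n xs)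
take-∷ʳ n xs x with length (xs ∷ʳ x) ≤? n
... | yes fits = trans (take-all n _ fits) (sym (if-≤ᵇ fits))
... | no  long = trans (take-++ˡ n xs (x ∷ []) n≤xs) (sym (if-≰ᵇ long))
  where
    n≤xs : n ≤ length xs
    n≤xs = ≤-pred (≤-trans (≰⇒> long) (≤-reflexive (trans (length-++ xs) (+-comm (length xs) 1))))

≤-slack : ∀ {m n o} d → m + d ≡ n → n ≤ o → m ≤ o
≤-slack {m} d refl n≤o = ≤-trans (m≤m+n m d) n≤o

within-budget : ∀ {c a N} d → c + d ≡ 2 * a + 8 → a ≤ N → c ≤ 2 * N + 8
within-budget d e a≤N = ≤-slack d e (+-monoˡ-≤ 8 (*-monoʳ-≤ 2 a≤N))

quadratic-bound : ∀ {a n} → a ≤ n → suc a * (2 * n + 8) ≤ 8 * suc n ^ 2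
quadratic-bound {a} {n} a≤n =
  ≤-trans (*-mono-≤ (s≤s a≤n) (≤-slack (6 * n) (linear n) ≤-refl)) (≤-reflexive (square (suc n)))
  where
    linear : ∀ m → 2 * m + 8 + 6 * m ≡ 8 * suc m
    linear = solve-∀
    square : ∀ m → m * (8 * m) ≡ 8 * (m * (m * 1))
    square = solve-∀

module Run (M : TM) where

  mk : State M → List (Sym M) → List (Sym M) → Config M
  mk q l []      = conf q l (blank M) []
  mk q l (h ∷ r) = conf q l h r

  infix 4 _⟶[_]_
  _⟶[_]_ : Config M → ℕ → Config M → Set
  c ⟶[ n ] c' = Σ ℕ λ k → k ≤ n × run k c ≡ c'

  run-+ : ∀ m n (c : Config M) → run (m + n) c ≡ run n (run m c)
  run-+ zero    n c = refl
  run-+ (suc m) n c = run-+ m n (step c)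

  ⟶-refl : ∀ {c} → c ⟶[ 0 ] c
  ⟶-refl = 0 , z≤n , refl

  infixr 5 _▹_
  _▹_ : ∀ {c₁ c₂ c₃ m n} → c₁ ⟶[ m ] c₂ → c₂ ⟶[ n ] c₃ → c₁ ⟶[ m + n ] c₃
  _▹_ {c₁} (k , k≤m , e) (k' , k'≤n , e') =
    k + k' , +-mono-≤ k≤m k'≤n , trans (run-+ k k' c₁) (trans (cong (run k') e) e')

  ⟶-weaken : ∀ {c c' m n} → m ≤ n → c ⟶[ m ] c' → c ⟶[ n ] c'
  ⟶-weaken m≤n (k , k≤m , e) = k , ≤-trans k≤m m≤n , e

  ⟶-cost : ∀ {c c' m n} → m ≡ n → c ⟶[ m ] c' → c ⟶[ n ] c'
  ⟶-cost refl r = r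

  ⟶-target : ∀ {c c' c'' n} → c' ≡ c'' → c ⟶[ n ] c' → c ⟶[ n ] c''
  ⟶-target refl r = r

  ⟶-step : ∀ {c c'} → step c ≡ c' → c ⟶[ 1 ] c'
  ⟶-step e = 1 , ≤-refl , e

  Passes : State M → Move → Sym M → Set
  Passes q m s = δ M q s ≡ just (q , s , m)

  step-R : ∀ {q q' h h' l} r → δ M q h ≡ just (q' , h' , R) →
           mk q l (h ∷ r) ⟶[ 1 ] mk q' (h' ∷ l) r
  step-R r δ≡ = ⟶-step (moves r δ≡)
    where
      moves : ∀ {q q' h h' l} r → δ M q h ≡ just (q' , h' , R) →
              step (mk q l (h ∷ r)) ≡ mk q' (h' ∷ l) r
      moves []      δ≡ rewrite δ≡ = refl
      moves (x ∷ r) δ≡ rewrite δ≡ = refl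

  step-L : ∀ {q q' h h' x l r} → δ M q h ≡ just (q' , h' , L) →
           mk q (x ∷ l) (h ∷ r) ⟶[ 1 ] mk q' l (x ∷ h' ∷ r)
  step-L δ≡ = ⟶-step (moves δ≡)
    where
      moves : ∀ {q q' h h' x l r} → δ M q h ≡ just (q' , h' , L) →
              step (mk q (x ∷ l) (h ∷ r)) ≡ mk q' l (x ∷ h' ∷ r)
      moves δ≡ rewrite δ≡ = refl

  step-S : ∀ {q q' h h' l r} → δ M q h ≡ just (q' , h' , S) →
           mk q l (h ∷ r) ⟶[ 1 ] mk q' l (h' ∷ r)
  step-S δ≡ = ⟶-step (moves δ≡)
    where
      moves : ∀ {q q' h h' l r} → δ M q h ≡ just (q' , h' , S) →
              step (mk q l (h ∷ r)) ≡ mk q' l (h' ∷ r)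
      moves δ≡ rewrite δ≡ = refl

  scan-L : ∀ {q} vs {v l h r} → Passes q L h → All (Passes q L) vs →
           mk q (vs ʳ++ (v ∷ l)) (h ∷ r) ⟶[ suc (length vs) ] mk q l (v ∷ vs ++ h ∷ r)
  scan-L []       ph []       = step-L ph
  scan-L (w ∷ vs) ph (p ∷ ps) = ⟶-cost (+-comm _ 1) (scan-L vs ph ps ▹ step-L p)

  initConf≡mk : ∀ {k} (xs : Vec Str k) → initConf {M} xs ≡ mk zero [] (encode M xs)
  initConf≡mk xs with encode M xs
  ... | []     = refl
  ... | s ∷ ss = refl

  output-mk : ∀ q l xs → output (mk q l xs) ≡ readBits M xs
  output-mk q l []       = refl
  output-mk q l (x ∷ xs) = refl

  halted-mk : ∀ {q} l xs → (∀ s → δ M q s ≡ nothing) → Halted (mk q l xs)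
  halted-mk l []       halts = halts _
  halted-mk l (x ∷ xs) halts = halts x

  readBits-bits : ∀ bs {rest} → readBits M rest ≡ [] → readBits M (map (bitSym M) bs ++ rest) ≡ bs
  readBits-bits []           e = e
  readBits-bits (false ∷ bs) e = cong (false ∷_) (readBits-bits bs e)
  readBits-bits (true ∷ bs)  e = cong (true ∷_) (readBits-bits bs e)

  HaltsWithin : Config M → ℕ → Str → Set
  HaltsWithin c n out = Σ (Config M) λ c' → c ⟶[ n ] c' × Halted c' × output c' ≡ out

  _▹halts_ : ∀ {c c' m n out} → c ⟶[ m ] c' → HaltsWithin c' n out → HaltsWithin c (m + n) out
  r ▹halts (c'' , r' , halted , out) = c'' , r ▹ r' , halted , out

  halts-weaken : ∀ {c m n out} → m ≤ n → HaltsWithin c m out → HaltsWithin c n out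
  halts-weaken m≤n (c' , r , halted , out) = c' , ⟶-weaken m≤n r , halted , out

  halts-output : ∀ {c n out out'} → out ≡ out' → HaltsWithin c n out → HaltsWithin c n out'
  halts-output refl h = h

  ComputesWithin : ∀ {k} → (Vec Str k → Str) → ℕ → Vec Str k → Set
  ComputesWithin f n xs = HaltsWithin (mk zero [] (encode M xs)) n (f xs)

  isFP-by-runs : ∀ {k} (f : Vec Str k → Str) a d →
                 (∀ xs → ComputesWithin f (a * suc (inputSize xs) ^ d) xs) → IsFP f
  isFP-by-runs f a d runs = M , a , d , λ xs → fromInit (runs xs)
    where
      fromInit : ∀ {xs n} → ComputesWithin f n xs →
                 Σ ℕ λ k → k ≤ n × Halted (run {M} k (initConf xs)) × output (run {M} k (initConf xs)) ≡ f xs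
      fromInit {xs} (c , (k , k≤n , e) , halted , out) =
        k , k≤n , subst Halted (sym e') halted , trans (cong output e') out
        where e' : run {M} k (initConf xs) ≡ c
              e' = trans (cong (run k) (initConf≡mk xs)) e

module Comparison where

  pattern bit0   = suc zero
  pattern bit1   = suc (suc zero)
  pattern sep    = suc (suc (suc zero))
  pattern crossU = suc (suc (suc (suc zero)))
  pattern crossW = suc (suc (suc (suc (suc zero))))

  pattern nextU  = zero
  pattern skipU  = suc zero
  pattern nextW  = suc (suc zero)
  pattern rewind = suc (suc (suc zero))
  pattern toX    = suc (suc (suc (suc zero)))
  pattern toY    = suc (suc (suc (suc (suc zero))))
  pattern stop   = suc (suc (suc (suc (suc (suc zero)))))

  -- On u # w # x # y, cross off one bit of u and one of w per round trip;
  -- whichever runs out first decides whether the head parks on x or on y.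
  δC : Fin 7 → Fin 6 → Maybe (Fin 7 × Fin 6 × Move)
  δC nextU  bit0   = just (skipU , crossU , R)
  δC nextU  bit1   = just (skipU , crossU , R)
  δC nextU  sep    = just (toX , sep , R)
  δC skipU  bit0   = just (skipU , bit0 , R)
  δC skipU  bit1   = just (skipU , bit1 , R)
  δC skipU  sep    = just (nextW , sep , R)
  δC nextW  crossW = just (nextW , crossW , R)
  δC nextW  bit0   = just (rewind , crossW , S)
  δC nextW  bit1   = just (rewind , crossW , S)
  δC nextW  sep    = just (toY , sep , R)
  δC rewind crossU = just (nextU , crossU , R)
  δC rewind s      = just (rewind , s , L)
  δC toX    crossW = just (toX , crossW , R)
  δC toX    bit0   = just (toX , bit0 , R)
  δC toX    bit1   = just (toX , bit1 , R)
  δC toX    sep    = just (stop , sep , R)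
  δC toY    bit0   = just (toY , bit0 , R)
  δC toY    bit1   = just (toY , bit1 , R)
  δC toY    sep    = just (stop , sep , R)
  δC _      _      = nothing

  compareTM : TM
  compareTM = record { extra = 2 ; nstate = 6 ; δ = δC }

  open Run compareTM

  bit : Bool → Fin 6
  bit = bitSym compareTM

  skip-bits : ∀ q → (∀ b → Passes q R (bit b)) → ∀ bs {l r} →
              mk q l (map bit bs ++ r) ⟶[ length bs ] mk q (map bit bs ʳ++ l) r
  skip-bits q passes []               = ⟶-refl
  skip-bits q passes (b ∷ bs) {r = r} = step-R (map bit bs ++ r) (passes b) ▹ skip-bits q passes bs

  skip-crossW : ∀ q → Passes q R crossW → ∀ j {l r} →
                mk q l (replicate j crossW ++ r) ⟶[ j ] mk q (replicate j crossW ʳ++ l) r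
  skip-crossW q passes zero            = ⟶-refl
  skip-crossW q passes (suc j) {r = r} = step-R (replicate j crossW ++ r) passes ▹ skip-crossW q passes j

  passes-bits : ∀ {q m} → Passes q m bit0 → Passes q m bit1 → ∀ b → Passes q m (bit b)
  passes-bits p0 p1 false = p0
  passes-bits p0 p1 true  = p1

  cross-u : ∀ b → δC nextU (bit b) ≡ just (skipU , crossU , R)
  cross-u false = refl
  cross-u true  = refl

  cross-w : ∀ b → δC nextW (bit b) ≡ just (rewind , crossW , S)
  cross-w false = refl
  cross-w true  = refl

  rewind-bits : ∀ us {l h r} → Passes rewind L h →
                mk rewind (map bit us ʳ++ (crossU ∷ l)) (h ∷ r) ⟶[ suc (length us) ]
                mk rewind l (crossU ∷ map bit us ++ h ∷ r)
  rewind-bits us ph = ⟶-cost (cong suc (length-map bit us)) (scan-L (map bit us) ph (map⁺ (universal (passes-bits refl refl) us)))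

  rewind-crossW : ∀ j {v l h r} → Passes rewind L h →
                  mk rewind (replicate j crossW ʳ++ (v ∷ l)) (h ∷ r) ⟶[ suc j ]
                  mk rewind l (v ∷ replicate j crossW ++ h ∷ r)
  rewind-crossW j ph = ⟶-cost (cong suc (length-replicate j)) (scan-L (replicate j crossW) ph (replicate⁺ j refl))

  module Rounds (x y : Str) where

    alternatives : List (Fin 6)
    alternatives = map bit x ++ sep ∷ map bit y

    -- i bits of u and j bits of w crossed off, us and ws left
    round : ℕ → List Bool → ℕ → List Bool → Config compareTM
    round i us j ws =
      mk nextU (replicate i crossU) (map bit us ++ sep ∷ replicate j crossW ++ map bit ws ++ sep ∷ alternatives)

    parked : ∀ l t {out} → readBits compareTM t ≡ out → HaltsWithin (mk stop l t) 0 out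
    parked l t e = mk stop l t , ⟶-refl , halted-mk l t (λ _ → refl) , trans (output-mk stop l t) e

    seek-w : ∀ i u us j ws →
             round i (u ∷ us) j ws ⟶[ 1 + (length us + (1 + j)) ]
             mk nextW (replicate j crossW ʳ++ (sep ∷ map bit us ʳ++ (crossU ∷ replicate i crossU)))
                      (map bit ws ++ sep ∷ alternatives)
    seek-w i u us j ws = step-R _ (cross-u u) ▹ skip-bits skipU (passes-bits refl refl) us ▹ step-R _ refl ▹ skip-crossW nextW refl j

    accept : ∀ i j ws → HaltsWithin (round i [] j ws) (1 + (j + (length ws + 1)) + 0) x
    accept i j ws =
      (step-R _ refl ▹ skip-crossW toX refl j ▹ skip-bits toX (passes-bits refl refl) ws ▹ step-R _ refl)
      ▹halts parked _ _ (readBits-bits x refl)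

    reject : ∀ i u us j → HaltsWithin (round i (u ∷ us) j []) (1 + (length us + (1 + j)) + (1 + (length x + 1)) + 0) y
    reject i u us j =
      (seek-w i u us j [] ▹ step-R _ refl ▹ skip-bits toY (passes-bits refl refl) x ▹ step-R _ refl)
      ▹halts parked _ _ (subst (λ t → readBits compareTM t ≡ y) (++-identityʳ _) (readBits-bits y refl))

    round-trip : ∀ i u us j w ws →
                 round i (u ∷ us) j (w ∷ ws) ⟶[ 1 + (length us + (1 + j)) + (1 + (suc j + (suc (length us) + 1))) ]
                 round (suc i) us (suc j) ws
    round-trip i u us j w ws =
      ⟶-target (cong (λ t → mk nextU (replicate (suc i) crossU) (map bit us ++ sep ∷ t))
                     (replicate-++-∷ j crossW (map bit ws ++ sep ∷ alternatives)))
        (seek-w i u us j (w ∷ ws) ▹ step-S (cross-w w) ▹ rewind-crossW j refl ▹ rewind-bits us refl ▹ step-R _ refl)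

    decides : ∀ N i us j ws → length us + (j + length ws) + length x ≤ N →
           HaltsWithin (round i us j ws) (suc (length us) * (2 * N + 8)) (if length us ≤ᵇ length ws then x else y)
    decides N i [] j ws size =
      halts-weaken (≤-trans (within-budget (j + length ws + 2 * length x + 6) (slack j (length ws) (length x)) size)
                            (≤-reflexive (sym (*-identityˡ (2 * N + 8)))))
                   (accept i j ws)
      where
        slack : ∀ j w x → 1 + (j + (w + 1)) + 0 + (j + w + 2 * x + 6) ≡ 2 * (j + w + x) + 8
        slack = solve-∀
    decides N i (u ∷ us) j [] size =
      halts-weaken (≤-trans (within-budget (length us + j + length x + 6) (slack (length us) j (length x)) size)
                            (m≤m+n _ _))
                   (reject i u us j)
      where
        slack : ∀ a j x → 1 + (a + (1 + j)) + (1 + (x + 1)) + 0 + (a + j + x + 6) ≡ 2 * (suc a + (j + 0) + x) + 8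
        slack = solve-∀
    decides N i (u ∷ us) j (w ∷ ws) size =
      halts-output (cong (if_then x else y) (sym (≤ᵇ-suc (length us) (length ws))))
        (halts-weaken (+-monoˡ-≤ _ trip-cost)
          (round-trip i u us j w ws ▹halts decides N (suc i) us (suc j) ws (≤-slack 1 (shrinks a j (length ws) (length x)) size)))
      where
        a : ℕ
        a = length us
        slack : ∀ a j w x → 1 + (a + (1 + j)) + (1 + (suc j + (suc a + 1))) + (2 * w + 2 * x + 6)
                            ≡ 2 * (suc a + (j + suc w) + x) + 8
        slack = solve-∀
        shrinks : ∀ a j w x → a + (suc j + w) + x + 1 ≡ suc a + (j + suc w) + x
        shrinks = solve-∀
        trip-cost : 1 + (a + (1 + j)) + (1 + (suc j + (suc a + 1))) ≤ 2 * N + 8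
        trip-cost = within-budget (2 * length ws + 2 * length x + 6) (slack a j (length ws) (length x)) size

condF : Vec Str 4 → Str
condF (u ∷ w ∷ x ∷ y ∷ []) = if length u ≤ᵇ length w then x else y

condFP : IsFP condF
condFP = isFP-by-runs condF 8 2 λ { (u ∷ w ∷ x ∷ y ∷ []) → decide u w x y }
  where
    open Comparison
    open Run compareTM
    decide : ∀ u w x y → ComputesWithin condF (8 * suc (inputSize (u ∷ w ∷ x ∷ y ∷ [])) ^ 2) (u ∷ w ∷ x ∷ y ∷ [])
    decide u w x y =
      halts-weaken (quadratic-bound (m≤m+n (length u) _))
        (Rounds.decides x y _ 0 u 0 w (≤-slack (length y) (sizes (length u) (length w) (length x) (length y)) ≤-refl))
      where
        sizes : ∀ u w x y → u + (0 + w) + x + y ≡ u + (w + (x + (y + 0)))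
        sizes = solve-∀

ε : Str
ε = []

emptyF : Vec Str 0 → Str
emptyF [] = ε

emptyFP : IsFP emptyF
emptyFP = haltingTM , 0 , 0 , λ { [] → 0 , z≤n , refl , refl }
  where
    haltingTM : TM
    haltingTM = record { extra = 0 ; nstate = 0 ; δ = λ _ _ → nothing }

cap : Str → Str → Str
cap t s = if length t ≤ᵇ length s then t else s

length-cap : ∀ t s → length (cap t s) ≤ length s
length-cap t s with length t ≤? length s
... | yes t≤s = ≤-trans (≤-reflexive (cong length (if-≤ᵇ t≤s))) t≤s
... | no  t≰s = ≤-reflexive (cong length (if-≰ᵇ t≰s))

R'rev-cong : ∀ {φ φ'} a ψ → (∀ x y → φ x y ≡ φ' x y) → ∀ rc → R'rev φ a ψ rc ≡ R'rev φ' a ψ rc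
R'rev-cong a ψ φ≗φ' []       = refl
R'rev-cong {φ} {φ'} a ψ φ≗φ' (i ∷ rc) =
  cong (λ t → cap t (ψ ci)) (trans (φ≗φ' ci _) (cong (φ' ci) (R'rev-cong a ψ φ≗φ' rc)))
  where ci = reverse (i ∷ rc)

Rrev-as-R'rev : ∀ φ a b rc → Rrev φ a b rc ≡ R'rev (λ x y → take (length b) (φ x y)) a (λ _ → b) rc
Rrev-as-R'rev φ a b []       = refl
Rrev-as-R'rev φ a b (i ∷ rc) =
  trans (cong (λ r → take (length b) (φ ci r)) (Rrev-as-R'rev φ a b rc))
        (sym (if-≤ᵇ (length-take≤n (length b) _)))
  where ci = reverse (i ∷ rc)

R'rev-take : ∀ (b s : Str) rc → length rc ≤ length s →
             R'rev (λ p r → if length p ≤ᵇ length b then p else r) ε (λ _ → s) rc ≡ take (length b) (reverse rc)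
R'rev-take b s []       _    = sym (take-[] (length b))
R'rev-take b s (i ∷ rc) ci≤s = begin
    cap (if length ci ≤ᵇ length b then ci else R'rev _ ε (λ _ → s) rc) s
      ≡⟨ cong (λ r → cap (if length ci ≤ᵇ length b then ci else r) s) (R'rev-take b s rc (≤-trans (n≤1+n _) ci≤s)) ⟩
    cap (if length ci ≤ᵇ length b then ci else take (length b) (reverse rc)) s
      ≡⟨ cong (λ t → cap t s) (subst (λ c → (if length c ≤ᵇ length b then c else take (length b) (reverse rc)) ≡ take (length b) c)
                                     (sym (unfold-reverse i rc)) (sym (take-∷ʳ (length b) (reverse rc) i))) ⟩
    cap (take (length b) ci) s
      ≡⟨ if-≤ᵇ (≤-trans (length-take≤length (length b) ci) (≤-trans (≤-reflexive (length-reverse (i ∷ rc))) ci≤s)) ⟩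
    take (length b) ci ∎
  where
    open ≡-Reasoning
    ci = reverse (i ∷ rc)

BoundedOnPrefixes : (Str → Str) → ℕ → List Bool → Set
BoundedOnPrefixes ψ n []       = ⊤
BoundedOnPrefixes ψ n (i ∷ rc) = length (ψ (reverse (i ∷ rc))) ≤ n × BoundedOnPrefixes ψ n rc

BoundedOnPrefixes-weaken : ∀ {ψ m n} rc → m ≤ n → BoundedOnPrefixes ψ m rc → BoundedOnPrefixes ψ n rc
BoundedOnPrefixes-weaken []       m≤n _                 = tt
BoundedOnPrefixes-weaken (i ∷ rc) m≤n (ψci≤m , bounded) =
  ≤-trans ψci≤m m≤n , BoundedOnPrefixes-weaken rc m≤n bounded

R'rev-as-Rrev : ∀ φ a ψ b rc → BoundedOnPrefixes ψ (length b) rc →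
                Rrev (λ x y → cap (φ x y) (ψ x)) a b rc ≡ R'rev φ a ψ rc
R'rev-as-Rrev φ a ψ b []       _                  = refl
R'rev-as-Rrev φ a ψ b (i ∷ rc) (ψci≤b , bounded) rewrite R'rev-as-Rrev φ a ψ b rc bounded =
  take-all (length b) _ (≤-trans (length-cap (φ ci (R'rev φ a ψ rc)) (ψ ci)) ψci≤b)
  where ci = reverse (i ∷ rc)

longerImage : (Str → Str) → Str → Str → Str
longerImage ψ x y = if length (ψ x) ≤ᵇ length (ψ y) then y else x

-- Truncating to |b| never bites: every value is a or a prefix of reverse rc.
Rrev-longerImage : ∀ ψ a b rc → length a ≤ length b → length rc ≤ length b →
  let m = Rrev (longerImage ψ) a b rc
  in length m ≤ length b × BoundedOnPrefixes ψ (length (ψ m)) rc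
Rrev-longerImage ψ a b []       a≤b _    = a≤b , tt
Rrev-longerImage ψ a b (i ∷ rc) a≤b ci≤b =
  keepLonger (Rrev-longerImage ψ a b rc a≤b (≤-trans (n≤1+n _) ci≤b)) (length (ψ ci) ≤? length (ψ m))
  where
    ci = reverse (i ∷ rc)
    m = Rrev (longerImage ψ) a b rc

    Maximal : Str → Set
    Maximal v = length v ≤ length b × BoundedOnPrefixes ψ (length (ψ v)) (i ∷ rc)

    ci≤b' : length ci ≤ length b
    ci≤b' = ≤-trans (≤-reflexive (length-reverse (i ∷ rc))) ci≤b

    keepLonger : length m ≤ length b × BoundedOnPrefixes ψ (length (ψ m)) rc →
                 Dec (length (ψ ci) ≤ length (ψ m)) → Maximal (take (length b) (longerImage ψ ci m))
    keepLonger (m≤b , bounded) (yes ψci≤ψm) =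
      subst Maximal (sym (trans (cong (take (length b)) (if-≤ᵇ ψci≤ψm)) (take-all (length b) m m≤b)))
            (m≤b , ψci≤ψm , bounded)
    keepLonger (m≤b , bounded) (no ψci≰ψm) =
      subst Maximal (sym (trans (cong (take (length b)) (if-≰ᵇ ψci≰ψm)) (take-all (length b) ci ci≤b')))
            (ci≤b' , ≤-refl , BoundedOnPrefixes-weaken rc (<⇒≤ (≰⇒> ψci≰ψm)) bounded)

fpConst : ∀ {X : Class} {Γ k} → (∀ {τ F} → FPClass τ F → X τ F) →
          (f : Vec Str k → Str) → IsFP f → Term X Γ (arr k)
fpConst embed f isFP = const (curryV _ f) (embed (fp f isFP))

infixl 9 _·_
_·_ : ∀ {X Γ σ τ} → Term X Γ (σ ⇒ τ) → Term X Γ σ → Term X Γ τ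
_·_ = app

v0 : ∀ {X Γ σ} → Term X (σ ∷ Γ) σ
v0 = var here
v1 : ∀ {X Γ σ τ} → Term X (τ ∷ σ ∷ Γ) σ
v1 = var (there here)
v2 : ∀ {X Γ σ τ ρ} → Term X (ρ ∷ τ ∷ σ ∷ Γ) σ
v2 = var (there (there here))
v3 : ∀ {X Γ σ τ ρ κ} → Term X (κ ∷ ρ ∷ τ ∷ σ ∷ Γ) σ
v3 = var (there (there (there here)))
v5 : ∀ {X Γ σ τ ρ κ μ ν} → Term X (ν ∷ μ ∷ κ ∷ ρ ∷ τ ∷ σ ∷ Γ) σ
v5 = var (there (there (there (there (there here)))))

-- λ b s. 𝓡' (λ p r. cond p b p r) ε (λ _. s) s
truncTerm : ∀ {Γ} → Term FP+R' Γ (ι ⇒ ι ⇒ ι)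
truncTerm = lam (lam
  (const 𝓡' R'C
    · lam (lam (fpConst fpC condF condFP · v1 · v3 · v1 · v0))
    · fpConst fpC emptyF emptyFP
    · lam v1
    · v0))

⟦truncTerm⟧ : ∀ {Γ} (ρ : Env Γ) b s → ⟦ truncTerm ⟧ ρ b s ≡ take (length b) s
⟦truncTerm⟧ ρ b s =
  trans (R'rev-take b s (reverse s) (≤-reflexive (length-reverse s)))
        (cong (take (length b)) (reverse-involutive s))

-- λ φ a b c. 𝓡' (λ x y. trunc b (φ x y)) a (λ _. b) c
R-term : ClosedTerm FP+R' TyR
R-term = lam (lam (lam (lam
  (const 𝓡' R'C · lam (lam (truncTerm · v3 · (v5 · v1 · v0))) · v2 · lam v2 · v0))))

-- λ φ a ψ c. 𝓡 (λ x y. cap (φ x y) (ψ x)) a (ψ m) c,  where m = 𝓡 (longerImage ψ) c c c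
R'-term : ClosedTerm FP+R TyR'
R'-term = lam (lam (lam (lam
  (const 𝓡 RC
    · lam (lam (cond · (v5 · v1 · v0) · (v3 · v1) · (v5 · v1 · v0) · (v3 · v1)))
    · v2
    · (v1 · (const 𝓡 RC · lam (lam (cond · (v3 · v1) · (v3 · v0) · v0 · v1)) · v0 · v0 · v0))
    · v0))))
  where
    cond : ∀ {Γ} → Term FP+R Γ (arr 4)
    cond = fpConst fpC condF condFP

mainTheorem5 :
    (Σ (ClosedTerm FP+R' TyR) λ t →
       ∀ φ a b c → ⟦ t ⟧ [] φ a b c ≡ 𝓡 φ a b c)
    ×
    (Σ (ClosedTerm FP+R TyR') λ t →
       ∀ φ a ψ c → ⟦ t ⟧ [] φ a ψ c ≡ 𝓡' φ a ψ c)
mainTheorem5 = (R-term , R-represented) , (R'-term , R'-represented)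
  where
    R-represented : ∀ φ a b c → ⟦ R-term ⟧ [] φ a b c ≡ 𝓡 φ a b c
    R-represented φ a b c =
      sym (trans (Rrev-as-R'rev φ a b (reverse c))
                 (R'rev-cong a (λ _ → b) (λ x y → sym (⟦truncTerm⟧ (y ∷ x ∷ c ∷ b ∷ a ∷ φ ∷ []) b (φ x y)))
                             (reverse c)))

    R'-represented : ∀ φ a ψ c → ⟦ R'-term ⟧ [] φ a ψ c ≡ 𝓡' φ a ψ c
    R'-represented φ a ψ c =
      R'rev-as-Rrev φ a ψ (ψ (𝓡 (longerImage ψ) c c c)) (reverse c)
        (proj₂ (Rrev-longerImage ψ c c (reverse c) ≤-refl (≤-reflexive (length-reverse c))))
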